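{- For the \textsc{Pagination} optimization problem, minimizing the number of pages and minimizing the number of symbol replications are not equivalent: there exist a finite collection $T$ of tiles and a capacity $C$ such that some valid pagination of $T$ with the minimum possible number of pages does not minimize the number of symbol replications among valid paginations, and some valid pagination of $T$ minimizing the number of symbol replications does not have the minimum possible number of pages.
   Context: An instance consists of a finite collection $T$ of nonempty finite sets (tiles) of symbols and an integer capacity $C>0$. A valid pagination is a partition of $T$ into nonempty parts (pages) such that each page $P$ satisfies $\left|\bigcup_{t\in P} t\right|\le C$. The number of symbol replications of a pagination is $\sum_{s}(k_s-1)$, where the sum is over all symbols $s$ occurring in some tile and $k_s$ is the number of pages $P$ with $s\in\bigcup_{t\in P}t$. -}

module Defs where

open import Data.Nat using (ℕ; _≤_; _<_; _∸_; _≟_)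
open import Data.Fin using (Fin)
open import Data.Nat.ListAction using (sum)
open import Data.Fin.Properties using () renaming (_≟_ to _≟ᶠ_)
open import Data.List using (List; []; length; filter; concat; map; deduplicate; allFin)
open import Data.List.Membership.DecPropositional _≟_ using (_∈?_)
open import Data.Product using (Σ; ∃; _×_)
open import Relation.Binary.PropositionalEquality using (_≡_; _≢_)

-- Symbols are natural numbers; a tile is a finite set of symbols, represented
-- by a list (duplicates irrelevant: only membership / deduplicated length is used).
Tile : Set
Tile = List ℕ

Tiles : ℕ → Set
Tiles n = Fin n → Tile

NonemptyTiles : ∀ {n} → Tiles n → Set
NonemptyTiles {n} T = ∀ (i : Fin n) → T i ≢ []

record Pagination (n : ℕ) : Set where
  field
    pages  : ℕ
    assign : Fin n → Fin pages
    onto   : ∀ (p : Fin pages) → ∃ λ (i : Fin n) → assign i ≡ p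
open Pagination public

tilesOn : ∀ {n} (P : Pagination n) → Fin (pages P) → List (Fin n)
tilesOn {n} P p = filter (λ i → assign P i ≟ᶠ p) (allFin n)

pageSymbols : ∀ {n} → Tiles n → (P : Pagination n) → Fin (pages P) → List ℕ
pageSymbols T P p = deduplicate _≟_ (concat (map T (tilesOn P p)))

Valid : ∀ {n} → Tiles n → ℕ → Pagination n → Set
Valid T C P = ∀ (p : Fin (pages P)) → length (pageSymbols T P p) ≤ C

allSymbols : ∀ {n} → Tiles n → List ℕ
allSymbols {n} T = deduplicate _≟_ (concat (map T (allFin n)))

pageCount : ∀ {n} → Tiles n → (P : Pagination n) → ℕ → ℕ
pageCount T P s = length (filter (λ p → s ∈? pageSymbols T P p) (allFin (pages P)))

replications : ∀ {n} → Tiles n → Pagination n → ℕ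
replications T P = sum (map (λ s → pageCount T P s ∸ 1) (allSymbols T))

-- Tiles {1,2,3}, {4,5}, {4,6}, {7,8,9} with capacity 5. The nine symbols do not fit on
-- one page, and two pages force the pair {4,5}, {4,6} apart (otherwise a page holds six
-- symbols), replicating 4. Three pages {1,2,3}, {4,5,6}, {7,8,9} replicate nothing.
module Submission where

open import Defs
open import Data.Nat using (ℕ; _≤_; _<_; zero; suc; z≤n; s≤s; _≤?_; _≟_)
open import Data.Nat.Properties using (<⇒≱; ≤-refl)
open import Data.Product using (Σ; ∃; _×_; _,_)
open import Data.Fin using (Fin; zero; suc)
open import Data.Fin.Properties using () renaming (_≟_ to _≟ᶠ_)
open import Data.List using ([]; _∷_; allFin; length; map; concat; deduplicate)
open import Data.List.Properties using (filter-all)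
open import Data.List.Relation.Unary.All using (universal)
open import Data.Empty using (⊥-elim)
open import Relation.Nullary.Decidable using (toWitness)
open import Relation.Binary.PropositionalEquality using (_≡_; refl; cong; subst)

tilesOn-all : ∀ {n} (P : Pagination n) (p : Fin (pages P)) →
              (∀ i → assign P i ≡ p) → tilesOn P p ≡ allFin n
tilesOn-all P p all-on-p = filter-all (λ i → assign P i ≟ᶠ p) (universal all-on-p _)

pageSymbols-all : ∀ {n} (T : Tiles n) (P : Pagination n) (p : Fin (pages P)) →
                  (∀ i → assign P i ≡ p) → pageSymbols T P p ≡ allSymbols T
pageSymbols-all T P p all-on-p =
  cong (λ is → deduplicate _≟_ (concat (map T is))) (tilesOn-all P p all-on-p)

Fin1-unique : (i : Fin 1) → i ≡ zero
Fin1-unique zero = refl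

two≤pages : ∀ {n} (T : Tiles (suc n)) (C : ℕ) → C < length (allSymbols T) →
            (Q : Pagination (suc n)) → Valid T C Q → 2 ≤ pages Q
two≤pages T C overfull record { pages = zero ; assign = f } _ with f zero
... | ()
two≤pages T C overfull Q@record { pages = suc zero } valid =
  ⊥-elim (<⇒≱ overfull (subst (λ xs → length xs ≤ C) one-page (valid zero)))
  where
  one-page : pageSymbols T Q zero ≡ allSymbols T
  one-page = pageSymbols-all T Q zero (λ i → Fin1-unique (assign Q i))
two≤pages T C overfull record { pages = suc (suc _) } _ = s≤s (s≤s z≤n)

tiles : Tiles 4
tiles zero                   = 1 ∷ 2 ∷ 3 ∷ []
tiles (suc zero)             = 4 ∷ 5 ∷ []
tiles (suc (suc zero))       = 4 ∷ 6 ∷ []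
tiles (suc (suc (suc zero))) = 7 ∷ 8 ∷ 9 ∷ []

tiles-nonempty : NonemptyTiles tiles
tiles-nonempty zero                   ()
tiles-nonempty (suc zero)             ()
tiles-nonempty (suc (suc zero))       ()
tiles-nonempty (suc (suc (suc zero))) ()

twoPages : Pagination 4
twoPages = record { pages = 2 ; assign = page ; onto = onto′ }
  where
  page : Fin 4 → Fin 2
  page zero                   = zero
  page (suc zero)             = zero
  page (suc (suc zero))       = suc zero
  page (suc (suc (suc zero))) = suc zero

  onto′ : (p : Fin 2) → ∃ λ i → page i ≡ p
  onto′ zero       = zero , refl
  onto′ (suc zero) = suc (suc zero) , refl

threePages : Pagination 4
threePages = record { pages = 3 ; assign = page ; onto = onto′ }
  where
  page : Fin 4 → Fin 3
  page zero                   = zero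
  page (suc zero)             = suc zero
  page (suc (suc zero))       = suc zero
  page (suc (suc (suc zero))) = suc (suc zero)

  onto′ : (p : Fin 3) → ∃ λ i → page i ≡ p
  onto′ zero             = zero , refl
  onto′ (suc zero)       = suc zero , refl
  onto′ (suc (suc zero)) = suc (suc (suc zero)) , refl

twoPages-valid : Valid tiles 5 twoPages
twoPages-valid zero       = toWitness {a? = _ ≤? 5} _
twoPages-valid (suc zero) = toWitness {a? = _ ≤? 5} _

threePages-valid : Valid tiles 5 threePages
threePages-valid zero             = toWitness {a? = _ ≤? 5} _
threePages-valid (suc zero)       = toWitness {a? = _ ≤? 5} _
threePages-valid (suc (suc zero)) = toWitness {a? = _ ≤? 5} _

twoPages-minimal : ∀ Q → Valid tiles 5 Q → pages twoPages ≤ pages Q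
twoPages-minimal = two≤pages tiles 5 (toWitness {a? = 6 ≤? 9} _)

threePages-replication-free : replications tiles threePages ≡ 0
threePages-replication-free = refl

twoPages-replicates : replications tiles twoPages ≡ 1
twoPages-replicates = refl

threePages-optimal : ∀ Q → Valid tiles 5 Q → replications tiles threePages ≤ replications tiles Q
threePages-optimal Q _ rewrite threePages-replication-free = z≤n

proposition2 : Σ ℕ λ n → Σ (Tiles n) λ T → Σ ℕ λ C →
    NonemptyTiles T × (0 < C) ×
    (Σ (Pagination n) λ P →
    Valid T C P
    × (∀ (Q : Pagination n) → Valid T C Q → pages P ≤ pages Q)
    × (Σ (Pagination n) λ Q → Valid T C Q × (replications T Q < replications T P)))
    ×
    (Σ (Pagination n) λ P →
    Valid T C P
    × (∀ (Q : Pagination n) → Valid T C Q → replications T P ≤ replications T Q)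
    × (Σ (Pagination n) λ Q → Valid T C Q × (pages Q < pages P)))
proposition2 = 4 , tiles , 5 , tiles-nonempty , s≤s z≤n ,
  (twoPages , twoPages-valid , twoPages-minimal ,
     threePages , threePages-valid , fewer-replications) ,
  (threePages , threePages-valid , threePages-optimal ,
     twoPages , twoPages-valid , ≤-refl)
  where
  fewer-replications : replications tiles threePages < replications tiles twoPages
  fewer-replications rewrite threePages-replication-free | twoPages-replicates = s≤s z≤n
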